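{- Let $G$ be a graph with $\chi'(G)=k$ and let $H$ be a $k$-dense subgraph of $G$. Then $H$ is an induced subgraph of $G$ with $\chi'(H)=\Gamma(H)=k$. Furthermore, for any $\varphi\in\mathcal{C}^k(G)$, $H$ is $\varphi_H$-elementary and strongly $\varphi$-closed.
   Context: Graphs are finite, loopless, possibly with multiple edges. $\mathcal{C}^k(G)$ is the set of proper edge colorings of $G$ with colors from $[k]=\{1,\dots,k\}$ (adjacent edges, i.e. edges sharing an endvertex, get distinct colors), and $\chi'(G)$ is the least $k$ with $\mathcal{C}^k(G)\neq\emptyset$. A subgraph $H$ is $k$-dense if $|V(H)|$ is odd and $|E(H)|=(|V(H)|-1)k/2$. The density $\Gamma(G)$ is $\max\{2|E(H)|/(|V(H)|-1): H\subseteq G, |V(H)|\ge 3, |V(H)| \text{ odd}\}$ if $|V(G)|\ge3$ and $0$ otherwise. For a proper coloring $\varphi$ with palette $[k]$ and vertex $v$, $\varphi(v)$ is the set of colors of edges incident with $v$ and $\overline{\varphi}(v)=[k]\setminus\varphi(v)$. $\varphi_H$ is the restriction of $\varphi$ to $E(H)$ (viewed as a coloring of $H$). A vertex set $X$ (or a subgraph with vertex set $X$) is $\varphi$-elementary if $\overline{\varphi}(u)\cap\overline{\varphi}(v)=\emptyset$ for all distinct $u,v\in X$. With $\partial_G(X)$ the set of edges of $G$ with exactly one endvertex in $X$, $X$ is $\varphi$-closed if every color appearing on an edge of $\partial_G(X)$ is present at every vertex of $X$, and strongly $\varphi$-closed if moreover the colors on the edges of $\partial_G(X)$ are pairwise distinct.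 -}

module Defs where

open import Data.Nat using (ℕ; _+_; _*_; _∸_; _≤_; _<_)
open import Data.Fin using (Fin)
open import Data.Fin.Subset using (Subset; _∈_; _∉_; _⊆_; ∣_∣; ⊤)
open import Data.Fin.Subset.Properties using (∈⊤)
open import Data.Product using (Σ; ∃; _×_; _,_; proj₁; proj₂)
open import Data.Sum using (_⊎_)
open import Relation.Binary.PropositionalEquality using (_≡_; _≢_)
open import Relation.Nullary using (¬_)

-- A finite loopless multigraph: vertices Fin nV, edges Fin nE, each edge
-- has two distinct endpoints (parallel edges allowed).
record Graph : Set where
  field
    nV nE    : ℕ
    end₁     : Fin nE → Fin nV
    end₂     : Fin nE → Fin nV
    loopless : ∀ e → end₁ e ≢ end₂ e
open Graph public

Inc : (G : Graph) → Fin (nE G) → Fin (nV G) → Set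
Inc G e v = end₁ G e ≡ v ⊎ end₂ G e ≡ v

Adj : (G : Graph) → Fin (nE G) → Fin (nE G) → Set
Adj G e e' = e ≢ e' × ∃ λ v → Inc G e v × Inc G e' v

record Subgraph (G : Graph) : Set where
  field
    VS     : Subset (nV G)
    ES     : Subset (nE G)
    closed : ∀ e → e ∈ ES → end₁ G e ∈ VS × end₂ G e ∈ VS
open Subgraph public

whole : (G : Graph) → Subgraph G
whole G = record { VS = ⊤ ; ES = ⊤ ; closed = λ e _ → ∈⊤ , ∈⊤ }

_≤S_ : {G : Graph} → Subgraph G → Subgraph G → Set
H' ≤S H = (VS H' ⊆ VS H) × (ES H' ⊆ ES H)

∣V∣ ∣E∣ : {G : Graph} → Subgraph G → ℕ
∣V∣ H = ∣ VS H ∣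
∣E∣ H = ∣ ES H ∣

Colouring : {G : Graph} → Subgraph G → ℕ → Set
Colouring {G} H k = (e : Fin (nE G)) → e ∈ ES H → Fin k

Proper : {G : Graph} (H : Subgraph G) {k : ℕ} → Colouring H k → Set
Proper {G} H c = ∀ e e' (p : e ∈ ES H) (p' : e' ∈ ES H) →
                 Adj G e e' → c e p ≢ c e' p'

𝒞 : {G : Graph} → ℕ → Subgraph G → Set
𝒞 k H = Σ (Colouring H k) (Proper H)

χ'≡ : {G : Graph} → Subgraph G → ℕ → Set
χ'≡ H k = 𝒞 k H × (∀ j → j < k → ¬ 𝒞 j H)

Odd : ℕ → Set
Odd n = ∃ λ j → n ≡ 1 + 2 * j

Dense : {G : Graph} → ℕ → Subgraph G → Set
Dense k H = Odd (∣V∣ H) × 2 * ∣E∣ H ≡ (∣V∣ H ∸ 1) * k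

Induced : {G : Graph} → Subgraph G → Set
Induced {G} H = ∀ e → end₁ G e ∈ VS H → end₂ G e ∈ VS H → e ∈ ES H

-- Γ(H) = k (k a natural number).  Γ(H) is 0 if |V(H)| < 3, and otherwise
-- the maximum of 2|E(H')|/(|V(H')|-1) over subgraphs H' of H with
-- |V(H')| odd and ≥ 3; "this maximum equals k" is: k is an upper bound
-- of all these ratios and is attained (ratios cleared of denominators).
Γ≡ : {G : Graph} → Subgraph G → ℕ → Set
Γ≡ H k =
  (∣V∣ H < 3 × k ≡ 0)
  ⊎ (3 ≤ ∣V∣ H
     × (∀ H' → H' ≤S H → Odd (∣V∣ H') → 3 ≤ ∣V∣ H' →
          2 * ∣E∣ H' ≤ k * (∣V∣ H' ∸ 1))
     × (∃ λ H' → H' ≤S H × Odd (∣V∣ H') × 3 ≤ ∣V∣ H' ×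
          2 * ∣E∣ H' ≡ k * (∣V∣ H' ∸ 1)))

Missing : {G : Graph} (H : Subgraph G) {k : ℕ} → Colouring H k →
          Fin (nV G) → Fin k → Set
Missing {G} H c v α = ∀ e (p : e ∈ ES H) → Inc G e v → c e p ≢ α

Elementary : {G : Graph} (H : Subgraph G) {k : ℕ} → Colouring H k →
             Subset (nV G) → Set
Elementary H c X = ∀ u v → u ∈ X → v ∈ X → u ≢ v →
                   ∀ α → ¬ (Missing H c u α × Missing H c v α)

restrict : {G : Graph} {k : ℕ} → Colouring (whole G) k → (H : Subgraph G) →
           Colouring H k
restrict φ H e _ = φ e ∈⊤

Boundary : (G : Graph) → Subset (nV G) → Fin (nE G) → Set
Boundary G X e = (end₁ G e ∈ X × end₂ G e ∉ X) ⊎ (end₁ G e ∉ X × end₂ G e ∈ X)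

Present : {G : Graph} {k : ℕ} → Colouring (whole G) k → Fin (nV G) → Fin k → Set
Present {G} φ v α = ∃ λ e → Inc G e v × φ e ∈⊤ ≡ α

Closed : {G : Graph} {k : ℕ} → Colouring (whole G) k → Subset (nV G) → Set
Closed {G} φ X = ∀ e → Boundary G X e → ∀ v → v ∈ X → Present {G} φ v (φ e ∈⊤)

StronglyClosed : {G : Graph} {k : ℕ} → Colouring (whole G) k → Subset (nV G) → Set
StronglyClosed {G} φ X =
  Closed {G} φ X × (∀ e e' → Boundary G X e → Boundary G X e' → e ≢ e' →
                 φ e ∈⊤ ≢ φ e' ∈⊤)

-- Let |V(H)| = 2j + 1. In a proper colouring of H each colour class is a matching inside V(H),
-- hence has at most j edges, so |E(H)| ≤ (number of colours) · j. For odd subgraphs of H this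
-- gives Γ(H) ≤ k, and as |E(H)| = kj no colouring of H uses fewer than k colours. For
-- φ ∈ 𝒞ᵏ(G) the count is tight: each colour class of φ in H has exactly j edges, so at most one
-- vertex of H misses a given colour. This is elementarity; and an edge of G outside H misses its
-- own colour in H at each of its ends, so it has at most one end in V(H) (H is induced), its
-- colour is present at every other vertex of H, and two boundary edges of one colour would be
-- adjacent or leave two vertices missing that colour.

module Submission where

open import Defs
open import Data.Nat using (ℕ; zero; suc; _+_; _*_; _∸_; _≤_; _<_; z≤n; s≤s; NonZero)
open import Data.Nat.Properties hiding (_≟_)
open import Data.Fin using (Fin; zero; suc; punchIn)
open import Data.Vec.Functional using (removeAt)
open import Function using (_∘_; _∘′_; id)
open import Data.Fin.Properties using (any?; _≟_)
open import Data.Fin.Subset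
  using (Subset; _∈_; _∉_; _⊆_; _∩_; _─_; _-_; ⁅_⁆; ∣_∣; inside; outside; Empty)
open import Data.Fin.Subset.Properties
  using ( ∈⊤; _∈?_; nonempty?; Empty-unique; ∣⊥∣≡0; p─⊥≡p; p─q⊆p; x∈⁅x⁆; x∈p∩q⁻
        ; x∈p∧x≢y⇒x∈p-y; x∈p⇒∣p-x∣<∣p∣)
open import Data.Vec using ([]; _∷_; here; there; tabulate)
open import Data.Vec.Properties using ([]=⇒lookup; lookup∘tabulate)
open import Algebra.Properties.CommutativeMonoid.Sum +-0-commutativeMonoid
  using (sum; sum-syntax; sum-remove; sum-replicate-zero)
open import Algebra.Properties.CommutativeSemigroup *-commutativeSemigroup using (x∙yz≈y∙xz)
open import Data.Product using (∃; _×_; _,_; proj₁; proj₂)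
open import Data.Sum using (inj₁; inj₂)
open import Data.Empty using (⊥)
open import Relation.Binary.PropositionalEquality
open import Relation.Nullary using (¬_; Dec; does; yes; no; contradiction)
open import Relation.Nullary.Decidable using (_×-dec_; _⊎-dec_; decidable-stable)

x∈p─q⇒x∉q : ∀ {n} {x : Fin n} (p q : Subset n) → x ∈ p ─ q → x ∉ q
x∈p─q⇒x∉q (_ ∷ p) (inside ∷ q) () here
x∈p─q⇒x∉q (_ ∷ p) (_ ∷ q) (there x∈p─q) (there x∈q) = x∈p─q⇒x∉q p q x∈p─q x∈q

x∈p-y⇒x≢y : ∀ {n} {x y : Fin n} (p : Subset n) → x ∈ p - y → x ≢ y
x∈p-y⇒x≢y {y = y} p x∈p-y refl = x∈p─q⇒x∉q p ⁅ y ⁆ x∈p-y (x∈⁅x⁆ y)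

x∈p⇒∣p∣≡1+∣p-x∣ : ∀ {n} {x : Fin n} (p : Subset n) → x ∈ p → ∣ p ∣ ≡ suc ∣ p - x ∣
x∈p⇒∣p∣≡1+∣p-x∣ (inside ∷ p) here = cong (suc ∘′ ∣_∣) (sym (p─⊥≡p p))
x∈p⇒∣p∣≡1+∣p-x∣ (inside ∷ p) (there x∈p) = cong suc (x∈p⇒∣p∣≡1+∣p-x∣ p x∈p)
x∈p⇒∣p∣≡1+∣p-x∣ (outside ∷ p) (there x∈p) = x∈p⇒∣p∣≡1+∣p-x∣ p x∈p

x,y∈p⇒2+∣p-x-y∣≤∣p∣ : ∀ {n} {x y : Fin n} {p : Subset n} → x ∈ p → y ∈ p → x ≢ y →
                      2 + ∣ p - x - y ∣ ≤ ∣ p ∣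
x,y∈p⇒2+∣p-x-y∣≤∣p∣ x∈p y∈p x≢y =
  ≤-trans (s≤s (x∈p⇒∣p-x∣<∣p∣ (x∈p∧x≢y⇒x∈p-y y∈p (x≢y ∘′ sym)))) (x∈p⇒∣p-x∣<∣p∣ x∈p)

Empty⇒∣p∣≡0 : ∀ {n} {p : Subset n} → Empty p → ∣ p ∣ ≡ 0
Empty⇒∣p∣≡0 {n} p-empty = trans (cong ∣_∣ (Empty-unique p-empty)) (∣⊥∣≡0 n)

preimage : ∀ {n k} → (Fin n → Fin k) → Fin k → Subset n
preimage c α = tabulate (λ x → does (c x ≟ α))

∈-preimage⁻ : ∀ {n k} (c : Fin n → Fin k) {α x} → x ∈ preimage c α → c x ≡ α
∈-preimage⁻ c {α} {x} x∈ with c x ≟ α | trans (sym (lookup∘tabulate _ x)) ([]=⇒lookup x∈)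
... | yes cx≡α | _ = cx≡α

2*m≤1+2*n⇒m≤n : ∀ {m n} → 2 * m ≤ 1 + 2 * n → m ≤ n
2*m≤1+2*n⇒m≤n {m} {n} 2m≤1+2n = ≮⇒≥ λ n<m →
  1+n≰n (≤-trans (≤-reflexive (sym (*-suc 2 n))) (≤-trans (*-monoʳ-≤ 2 n<m) 2m≤1+2n))

∑-≤ : ∀ k (f : Fin k → ℕ) {m} → (∀ α → f α ≤ m) → ∑[ α < k ] f α ≤ k * m
∑-≤ zero f f≤m = z≤n
∑-≤ (suc k) f f≤m = +-mono-≤ (f≤m zero) (∑-≤ k (f ∘′ suc) (f≤m ∘ suc))

∑-≡-max⇒≥ : ∀ k (f : Fin k → ℕ) {m} → (∀ α → f α ≤ m) → ∑[ α < k ] f α ≡ k * m →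
            ∀ α → m ≤ f α
∑-≡-max⇒≥ (suc k) f {m} f≤m ∑f≡ α = +-cancelʳ-≤ (k * m) m (f α) (begin
  m + k * m                      ≡⟨ sym ∑f≡ ⟩
  sum f                          ≡⟨ sum-remove {i = α} f ⟩
  f α + sum (removeAt f α)       ≤⟨ +-monoʳ-≤ (f α) (∑-≤ k (removeAt f α) (f≤m ∘ punchIn α)) ⟩
  f α + k * m                    ∎)
  where open ≤-Reasoning

∑-∣does∷∣ : ∀ {k n} (x : Fin k) (q : Fin k → Subset n) →
            ∑[ α < k ] ∣ does (x ≟ α) ∷ q α ∣ ≡ suc (∑[ α < k ] ∣ q α ∣)
∑-∣does∷∣ zero q = refl
∑-∣does∷∣ (suc x) q = trans (cong (∣ q zero ∣ +_) (∑-∣does∷∣ x (q ∘′ suc))) (+-suc ∣ q zero ∣ _)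

colourClass : ∀ {n k} → Subset n → (Fin n → Fin k) → Fin k → Subset n
colourClass E c α = E ∩ preimage c α

∈colourClass⁻ : ∀ {n k} (E : Subset n) (c : Fin n → Fin k) {α x} →
                x ∈ colourClass E c α → x ∈ E × c x ≡ α
∈colourClass⁻ E c x∈ with x∈p∩q⁻ E _ x∈
... | x∈E , x∈c⁻¹α = x∈E , ∈-preimage⁻ c x∈c⁻¹α

∣E∣≡∑∣colourClass∣ : ∀ {n} k (E : Subset n) (c : Fin n → Fin k) →
                    ∣ E ∣ ≡ ∑[ α < k ] ∣ colourClass E c α ∣
∣E∣≡∑∣colourClass∣ k [] c = sym (sum-replicate-zero k)
∣E∣≡∑∣colourClass∣ k (outside ∷ E) c = ∣E∣≡∑∣colourClass∣ k E (c ∘′ suc)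
-- The last step is definitional: colourClass (inside ∷ E) c α unfolds to
-- does (c zero ≟ α) ∷ colourClass E (c ∘′ suc) α.
∣E∣≡∑∣colourClass∣ k (inside ∷ E) c = begin
  suc ∣ E ∣
    ≡⟨ cong suc (∣E∣≡∑∣colourClass∣ k E (c ∘′ suc)) ⟩
  suc (∑[ α < k ] ∣ colourClass E (c ∘′ suc) α ∣)
    ≡⟨ sym (∑-∣does∷∣ (c zero) (colourClass E (c ∘′ suc))) ⟩
  ∑[ α < k ] ∣ does (c zero ≟ α) ∷ colourClass E (c ∘′ suc) α ∣
    ∎
  where open ≡-Reasoning

module _ (G : Graph) where

  Covers : Subset (nE G) → Fin (nV G) → Set
  Covers M v = ∃ λ e → e ∈ M × Inc G e v

  covers? : ∀ M v → Dec (Covers M v)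
  covers? M v = any? λ e → e ∈? M ×-dec ((end₁ G e ≟ v) ⊎-dec (end₂ G e ≟ v))

  IsMatching : Subset (nE G) → Set
  IsMatching M = ∀ e f → e ∈ M → f ∈ M → ¬ Adj G e f

  EdgesWithin : Subset (nE G) → Subset (nV G) → Set
  EdgesWithin M X = ∀ e → e ∈ M → end₁ G e ∈ X × end₂ G e ∈ X

  matching-bound : ∀ {M X} → IsMatching M → EdgesWithin M X → 2 * ∣ M ∣ ≤ ∣ X ∣
  matching-bound {M} = bound ∣ M ∣ refl
    where
    bound : ∀ n {M X} → ∣ M ∣ ≡ n → IsMatching M → EdgesWithin M X → 2 * n ≤ ∣ X ∣
    bound zero _ _ _ = z≤n
    bound (suc n) {M} {X} ∣M∣≡1+n matching within with nonempty? M
    ... | no M-empty = contradiction (trans (sym ∣M∣≡1+n) (Empty⇒∣p∣≡0 M-empty)) λ ()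
    ... | yes (e , e∈M) = begin
      2 * suc n          ≡⟨ *-suc 2 n ⟩
      2 + 2 * n          ≤⟨ +-monoʳ-≤ 2 (bound n ∣M-e∣≡n matching′ within′) ⟩
      2 + ∣ X - a - b ∣  ≤⟨ x,y∈p⇒2+∣p-x-y∣≤∣p∣ (proj₁ (within e e∈M)) (proj₂ (within e e∈M))
                                                (loopless G e) ⟩
      ∣ X ∣              ∎
      where
      open ≤-Reasoning
      a = end₁ G e
      b = end₂ G e
      ∣M-e∣≡n : ∣ M - e ∣ ≡ n
      ∣M-e∣≡n = suc-injective (trans (sym (x∈p⇒∣p∣≡1+∣p-x∣ M e∈M)) ∣M∣≡1+n)
      M-e⊆M : M - e ⊆ M
      M-e⊆M = p─q⊆p M ⁅ e ⁆
      matching′ : IsMatching (M - e)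
      matching′ f f′ f∈ f′∈ = matching f f′ (M-e⊆M f∈) (M-e⊆M f′∈)
      disjoint-from-e : ∀ {f w} → f ∈ M - e → Inc G f w → ¬ Inc G e w
      disjoint-from-e f∈ f-w e-w = matching _ e (M-e⊆M f∈) e∈M (x∈p-y⇒x≢y M f∈ , _ , f-w , e-w)
      ∈X-a-b : ∀ {f w} → f ∈ M - e → w ∈ X → Inc G f w → w ∈ X - a - b
      ∈X-a-b f∈ w∈X f-w =
        x∈p∧x≢y⇒x∈p-y (x∈p∧x≢y⇒x∈p-y w∈X λ { refl → disjoint-from-e f∈ f-w (inj₁ refl) })
                      λ { refl → disjoint-from-e f∈ f-w (inj₂ refl) }
      within′ : EdgesWithin (M - e) (X - a - b)
      within′ f f∈ = ∈X-a-b f∈ (proj₁ (within f (M-e⊆M f∈))) (inj₁ refl)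
                   , ∈X-a-b f∈ (proj₂ (within f (M-e⊆M f∈))) (inj₂ refl)

  matching-bound-uncovered : ∀ {M X u v} → IsMatching M → EdgesWithin M X →
                             u ∈ X → v ∈ X → u ≢ v → ¬ Covers M u → ¬ Covers M v →
                             2 + 2 * ∣ M ∣ ≤ ∣ X ∣
  matching-bound-uncovered {M} {X} {u} {v} matching within u∈X v∈X u≢v u-free v-free = begin
    2 + 2 * ∣ M ∣      ≤⟨ +-monoʳ-≤ 2 (matching-bound matching within′) ⟩
    2 + ∣ X - u - v ∣  ≤⟨ x,y∈p⇒2+∣p-x-y∣≤∣p∣ u∈X v∈X u≢v ⟩
    ∣ X ∣              ∎
    where
    open ≤-Reasoning
    ∈X-u-v : ∀ {e w} → e ∈ M → w ∈ X → Inc G e w → w ∈ X - u - v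
    ∈X-u-v e∈M w∈X e-w =
      x∈p∧x≢y⇒x∈p-y (x∈p∧x≢y⇒x∈p-y w∈X λ { refl → u-free (_ , e∈M , e-w) })
                    λ { refl → v-free (_ , e∈M , e-w) }
    within′ : EdgesWithin M (X - u - v)
    within′ e e∈M = ∈X-u-v e∈M (proj₁ (within e e∈M)) (inj₁ refl)
                  , ∈X-u-v e∈M (proj₂ (within e e∈M)) (inj₂ refl)

  ProperOn : ∀ {k} → Subset (nE G) → (Fin (nE G) → Fin k) → Set
  ProperOn E c = ∀ e f → e ∈ E → f ∈ E → Adj G e f → c e ≢ c f

  colourClass-isMatching : ∀ {k E} {c : Fin (nE G) → Fin k} → ProperOn E c →
                           ∀ α → IsMatching (colourClass E c α)
  colourClass-isMatching {E = E} {c} proper α e f e∈ f∈ adj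
    with ∈colourClass⁻ E c e∈ | ∈colourClass⁻ E c f∈
  ... | e∈E , ce≡α | f∈E , cf≡α = proper e f e∈E f∈E adj (trans ce≡α (sym cf≡α))

  colourClass-within : ∀ {k E X} {c : Fin (nE G) → Fin k} → EdgesWithin E X →
                       ∀ α → EdgesWithin (colourClass E c α) X
  colourClass-within {E = E} {c = c} within α e e∈ = within e (proj₁ (∈colourClass⁻ E c e∈))

  module _ {k j} {X : Subset (nV G)} {E : Subset (nE G)} {c : Fin (nE G) → Fin k}
           (within : EdgesWithin E X) (proper : ProperOn E c) (∣X∣≡1+2j : ∣ X ∣ ≡ 1 + 2 * j)
           where

    colourClass-bound : ∀ α → ∣ colourClass E c α ∣ ≤ j
    colourClass-bound α = 2*m≤1+2*n⇒m≤n (subst (2 * ∣ colourClass E c α ∣ ≤_) ∣X∣≡1+2j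
      (matching-bound (colourClass-isMatching proper α) (colourClass-within {c = c} within α)))

    edges-bound : ∣ E ∣ ≤ k * j
    edges-bound = subst (_≤ k * j) (sym (∣E∣≡∑∣colourClass∣ k E c)) (∑-≤ k _ colourClass-bound)

    full-colourClass-covers : ∣ E ∣ ≡ k * j → ∀ α {u v} → u ∈ X → v ∈ X → u ≢ v →
                              ¬ Covers (colourClass E c α) u → Covers (colourClass E c α) v
    full-colourClass-covers ∣E∣≡kj α {u} {v} u∈X v∈X u≢v u-free =
      decidable-stable (covers? _ v) λ v-free → 1+n≰n (begin
        2 + 2 * j                      ≤⟨ +-monoʳ-≤ 2 (*-monoʳ-≤ 2 j≤∣class∣) ⟩
        2 + 2 * ∣ colourClass E c α ∣  ≤⟨ matching-bound-uncovered (colourClass-isMatching proper α)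
                                            (colourClass-within {c = c} within α)
                                            u∈X v∈X u≢v u-free v-free ⟩
        ∣ X ∣                          ≡⟨ ∣X∣≡1+2j ⟩
        1 + 2 * j                      ∎)
      where
      open ≤-Reasoning
      j≤∣class∣ : j ≤ ∣ colourClass E c α ∣
      j≤∣class∣ = ∑-≡-max⇒≥ k _ colourClass-bound
                    (trans (sym (∣E∣≡∑∣colourClass∣ k E c)) ∣E∣≡kj) α

boundary-end : ∀ (G : Graph) {X} e → Boundary G X e → ∃ λ u → u ∈ X × Inc G e u
boundary-end G e (inj₁ (a∈X , _)) = _ , a∈X , inj₁ refl
boundary-end G e (inj₂ (_ , b∈X)) = _ , b∈X , inj₂ refl

boundary-∉ : ∀ {G} (H : Subgraph G) {e} → Boundary G (VS H) e → e ∉ ES H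
boundary-∉ H (inj₁ (_ , b∉V)) e∈E = b∉V (proj₂ (closed H _ e∈E))
boundary-∉ H (inj₂ (a∉V , _)) e∈E = a∉V (proj₁ (closed H _ e∈E))

restrictColouring : ∀ {G k} → 𝒞 k (whole G) → (H : Subgraph G) → 𝒞 k H
restrictColouring (φ , φ-proper) H = restrict φ H , λ e f _ _ → φ-proper e f ∈⊤ ∈⊤

-- ψ is only defined on E(H); it is extended to all edges by the colour of some edge of H,
-- which exists unless E(H) is empty.
subgraph-edges-bound : ∀ {G} (H : Subgraph G) {i j} → ∣V∣ H ≡ 1 + 2 * j → 𝒞 i H → ∣E∣ H ≤ i * j
subgraph-edges-bound {G} H {i} {j} ∣V∣≡1+2j (ψ , ψ-proper) with nonempty? (ES H)
... | no E-empty = subst (_≤ i * j) (sym (Empty⇒∣p∣≡0 E-empty)) z≤n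
... | yes (e₀ , e₀∈E) = edges-bound G (closed H) proper ∣V∣≡1+2j
  where
  c : Fin (nE G) → Fin i
  c e with e ∈? ES H
  ... | yes e∈E = ψ e e∈E
  ... | no _ = ψ e₀ e₀∈E
  proper : ProperOn G (ES H) c
  proper e f e∈E f∈E adj with e ∈? ES H | f ∈? ES H
  ... | yes e∈E′ | yes f∈E′ = ψ-proper e f e∈E′ f∈E′ adj
  ... | no e∉E | _ = contradiction e∈E e∉E
  ... | _ | no f∉E = contradiction f∈E f∉E

module DenseSubgraph {G : Graph} {k j : ℕ} (H : Subgraph G)
                     (∣V∣≡1+2j : ∣V∣ H ≡ 1 + 2 * j) (∣E∣≡kj : ∣E∣ H ≡ k * j)
                     (φ : 𝒞 k (whole G)) where

  c : Fin (nE G) → Fin k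
  c e = proj₁ φ e ∈⊤

  class : Fin k → Subset (nE G)
  class = colourClass (ES H) c

  covers-other : ∀ α {u v} → u ∈ VS H → v ∈ VS H → u ≢ v →
                 ¬ Covers G (class α) u → Covers G (class α) v
  covers-other =
    full-colourClass-covers G (closed H) (λ e f _ _ → proj₂ φ e f ∈⊤ ∈⊤) ∣V∣≡1+2j ∣E∣≡kj

  not-both-free : ∀ α {u v} → u ∈ VS H → v ∈ VS H → u ≢ v →
                  ¬ Covers G (class α) u → ¬ Covers G (class α) v → ⊥
  not-both-free α u∈V v∈V u≢v u-free v-free = v-free (covers-other α u∈V v∈V u≢v u-free)

  outside-edge-frees-ends : ∀ {e u} → e ∉ ES H → Inc G e u → ¬ Covers G (class (c e)) u
  outside-edge-frees-ends {e} e∉E e-u (f , f∈ , f-u) with ∈colourClass⁻ (ES H) c f∈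
  ... | f∈E , cf≡ce = proj₂ φ f e ∈⊤ ∈⊤ ((λ { refl → e∉E f∈E }) , _ , f-u , e-u) cf≡ce

  induced : Induced H
  induced e a∈V b∈V with e ∈? ES H
  ... | yes e∈E = e∈E
  ... | no e∉E = contradiction (outside-edge-frees-ends e∉E (inj₂ refl))
                   (not-both-free (c e) a∈V b∈V (loopless G e)
                                  (outside-edge-frees-ends e∉E (inj₁ refl)))

  elementary : Elementary H (restrict (proj₁ φ) H) (VS H)
  elementary u v u∈V v∈V u≢v α (u-missing , v-missing) =
    not-both-free α u∈V v∈V u≢v (missing⇒free u-missing) (missing⇒free v-missing)
    where
    missing⇒free : ∀ {w} → Missing H (restrict (proj₁ φ) H) w α → ¬ Covers G (class α) w
    missing⇒free missing (f , f∈ , f-w) with ∈colourClass⁻ (ES H) c f∈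
    ... | f∈E , cf≡α = missing f f∈E f-w cf≡α

  closed′ : Closed {G} (proj₁ φ) (VS H)
  closed′ e ∂e v v∈V with boundary-end G e ∂e
  ... | u , u∈V , e-u with u ≟ v
  ... | yes refl = e , e-u , refl
  ... | no u≢v with covers-other (c e) u∈V v∈V u≢v (outside-edge-frees-ends (boundary-∉ H ∂e) e-u)
  ... | f , f∈ , f-v = f , f-v , proj₂ (∈colourClass⁻ (ES H) c f∈)

  strongly-closed : StronglyClosed {G} (proj₁ φ) (VS H)
  strongly-closed = closed′ , boundary-colours-distinct
    where
    boundary-colours-distinct : ∀ e f → Boundary G (VS H) e → Boundary G (VS H) f →
                                e ≢ f → c e ≢ c f
    boundary-colours-distinct e f ∂e ∂f e≢f ce≡cf with boundary-end G e ∂e | boundary-end G f ∂f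
    ... | u , u∈V , e-u | w , w∈V , f-w with u ≟ w
    ... | yes refl = proj₂ φ e f ∈⊤ ∈⊤ (e≢f , u , e-u , f-w) ce≡cf
    ... | no u≢w = not-both-free (c e) u∈V w∈V u≢w
                     (outside-edge-frees-ends (boundary-∉ H ∂e) e-u)
                     (subst (λ α → ¬ Covers G (class α) w) (sym ce≡cf)
                            (outside-edge-frees-ends (boundary-∉ H ∂f) f-w))

2*m≡[n∸1]*k⇒m≡k*j : ∀ {n m j k} → n ≡ 1 + 2 * j → 2 * m ≡ (n ∸ 1) * k → m ≡ k * j
2*m≡[n∸1]*k⇒m≡k*j {m = m} {j} {k} refl 2m≡2jk =
  *-cancelˡ-≡ m (k * j) 2 (trans 2m≡2jk (trans (*-assoc 2 j k) (cong (2 *_) (*-comm j k))))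

m≤k*j⇒2*m≤k*[n∸1] : ∀ {n m j k} → n ≡ 1 + 2 * j → m ≤ k * j → 2 * m ≤ k * (n ∸ 1)
m≤k*j⇒2*m≤k*[n∸1] {j = j} {k} refl m≤kj = ≤-trans (*-monoʳ-≤ 2 m≤kj) (≤-reflexive (x∙yz≈y∙xz 2 k j))

3≤1+2*j⇒NonZero : ∀ {j} → 3 ≤ 1 + 2 * j → NonZero j
3≤1+2*j⇒NonZero {zero} (s≤s ())
3≤1+2*j⇒NonZero {suc j} _ = _

lemma2p2 : (G : Graph) (k : ℕ) → χ'≡ (whole G) k →
           (H : Subgraph G) → Dense k H → 3 ≤ ∣V∣ H →
           Induced H × χ'≡ H k × Γ≡ H k ×
           (∀ (φ : 𝒞 k (whole G)) →
              Elementary H (restrict (proj₁ φ) H) (VS H) ×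
              StronglyClosed {G} (proj₁ φ) (VS H))
lemma2p2 G k (φ , _) H ((j , ∣V∣≡1+2j) , 2∣E∣≡) 3≤∣V∣ =
    DenseSubgraph.induced H ∣V∣≡1+2j ∣E∣≡kj φ
  , (restrictColouring φ H , fewer-colours-fail)
  , inj₂ (3≤∣V∣ , Γ-bound , H , (id , id) , (j , ∣V∣≡1+2j) , 3≤∣V∣ , trans 2∣E∣≡ (*-comm _ k))
  , λ ψ → DenseSubgraph.elementary H ∣V∣≡1+2j ∣E∣≡kj ψ
        , DenseSubgraph.strongly-closed H ∣V∣≡1+2j ∣E∣≡kj ψ
  where
  ∣E∣≡kj : ∣E∣ H ≡ k * j
  ∣E∣≡kj = 2*m≡[n∸1]*k⇒m≡k*j ∣V∣≡1+2j 2∣E∣≡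
  fewer-colours-fail : ∀ i → i < k → ¬ 𝒞 i H
  fewer-colours-fail i i<k ψ =
    <⇒≱ (*-monoˡ-< j {{3≤1+2*j⇒NonZero (subst (3 ≤_) ∣V∣≡1+2j 3≤∣V∣)}} i<k)
        (subst (_≤ i * j) ∣E∣≡kj (subgraph-edges-bound H ∣V∣≡1+2j ψ))
  Γ-bound : ∀ H′ → H′ ≤S H → Odd (∣V∣ H′) → 3 ≤ ∣V∣ H′ → 2 * ∣E∣ H′ ≤ k * (∣V∣ H′ ∸ 1)
  Γ-bound H′ _ (j′ , ∣V′∣≡1+2j′) _ =
    m≤k*j⇒2*m≤k*[n∸1] {j = j′} {k} ∣V′∣≡1+2j′
      (subgraph-edges-bound H′ {j = j′} ∣V′∣≡1+2j′ (restrictColouring φ H′))
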